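{- Let $\sigma\in\mathfrak S_n^{\bullet k}$. All paths $P\in\mathsf{stLSQ}(n)^{\bullet k}$ with diagonal word $\mathsf{dw}(P)=\sigma$ have the same area, namely $\mathsf{revmaj}(\sigma)$.
   Context: A square path of size $n$ is a lattice path from $(0,0)$ to $(n,n)$ of unit north (vertical) and east steps ending with an east step. The $j$-th diagonal is the set of unit squares with two vertices on $y=x+j$; each vertical step is identified with the unit square of which it is the left edge. Area word: $a_i=j$ if the $i$-th vertical step starts on $y=x+j$; shift $s=-\min_i a_i$; area $=\sum_i(a_i+s)$. A standard labeling is a permutation $w_1\cdots w_n$ of $1,\dots,n$ placed in the squares of the vertical steps, strictly increasing upward within columns. The $i$-th vertical step is a contractible valley if ($i>1$, $a_{i-1}>a_i$) or ($i>1$, $a_{i-1}=a_i$, $w_{i-1}<w_i$) or ($i=1$, $a_1\le-1$). $\mathsf{stLSQ}(n)^{\bullet k}$: standardly labeled square paths with exactly $k$ contractible valleys marked decorated. $\mathfrak S_n^{\bullet k}$: permutations of $[n]$ with exactly $k$ letters marked decorated. Diagonal word: for $P$ with shift $s$, $\rho_i$ is the list of labels in the $(i-s)$-th diagonal in decreasing order, each marked decorated if its step is, and $\mathsf{dw}(P)=\rho_0\rho_1\cdots$. $\mathsf{revmaj}(\sigma)$ is the major index $\sum_{i:\tau_i>\tau_{i+1}}i$ of the reversed word $\tau=\sigma_n\cdots\sigma_1$ (decorations ignored). -}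

module Defs where

open import Data.Nat as ℕ using (ℕ; zero; suc)
open import Data.Integer as ℤ using (ℤ; +_; -_)
open import Data.Bool using (Bool; true; false; _∧_; _∨_; not)
open import Data.List using (List; []; _∷_; map; filterᵇ; length; last; upTo; downFrom; concat; concatMap; reverse; zipWith; foldr)
open import Data.List.Relation.Binary.Permutation.Propositional using (_↭_)
open import Data.List.Relation.Unary.Linked using (Linked)
open import Data.List.Relation.Unary.All using (All)
open import Data.Maybe using (Maybe; just)
open import Data.Product using (_×_; _,_; proj₁; proj₂)
open import Relation.Nullary.Decidable using (⌊_⌋)
open import Relation.Binary.PropositionalEquality using (_≡_)

data Step : Set where
  N E : Step

isN : Step → Bool
isN N = true
isN E = false

isE : Step → Bool
isE s = not (isN s)

record IsSquarePath (n : ℕ) (p : List Step) : Set where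
  field
    northCount : length (filterᵇ isN p) ≡ n
    eastCount  : length (filterᵇ isE p) ≡ n
    endsEast   : last p ≡ just E

-- For each vertical step (in order, bottom to top), the pair (x , a) where
-- x is the x-coordinate of its starting point (x , y) and a = y - x is the
-- index j of the line y = x + j on which it starts (the area-word letter).
vstepsFrom : ℕ → ℕ → List Step → List (ℕ × ℤ)
vstepsFrom x y []       = []
vstepsFrom x y (N ∷ p)  = (x , (+ y) ℤ.- (+ x)) ∷ vstepsFrom x (suc y) p
vstepsFrom x y (E ∷ p)  = vstepsFrom (suc x) y p

vsteps : List Step → List (ℕ × ℤ)
vsteps = vstepsFrom 0 0

areaWord : List Step → List ℤ
areaWord p = map proj₂ (vsteps p)

-- minimum of a list of integers (0 for the empty list; never used for n ≥ 1)
minℤ : List ℤ → ℤ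
minℤ []       = + 0
minℤ (a ∷ as) = foldr ℤ._⊓_ a as

maxℤ : List ℤ → ℤ
maxℤ []       = + 0
maxℤ (a ∷ as) = foldr ℤ._⊔_ a as

shift : List Step → ℤ
shift p = - minℤ (areaWord p)

sumℤ : List ℤ → ℤ
sumℤ = foldr ℤ._+_ (+ 0)

area : List Step → ℤ
area p = sumℤ (map (λ a → a ℤ.+ shift p) (areaWord p))

record LPath : Set where
  constructor lpath
  field
    path   : List Step
    labels : List ℕ      -- w_1 … w_n : label of the i-th vertical step
    decos  : List Bool   -- true iff the i-th vertical step is decorated
open LPath public

-- consecutive vertical steps in the same column have increasing labels
ColOK : (ℕ × ℕ) → (ℕ × ℕ) → Set
ColOK (x , w) (x' , w') = x ≡ x' → w ℕ.< w'

cvTail : (ℤ × ℕ) → List (ℤ × ℕ) → List Bool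
cvTail _          []              = []
cvTail (a' , w') ((a , w) ∷ rest) =
  (⌊ a ℤ.<? a' ⌋ ∨ (⌊ a ℤ.≟ a' ⌋ ∧ ⌊ w' ℕ.<? w ⌋)) ∷ cvTail (a , w) rest

contractible : List (ℤ × ℕ) → List Bool
contractible []              = []
contractible ((a , w) ∷ rest) = ⌊ a ℤ.≤? ℤ.-[1+ 0 ] ⌋ ∷ cvTail (a , w) rest

contractibleValleys : LPath → List Bool
contractibleValleys P =
  contractible (zipWith _,_ (areaWord (path P)) (labels P))

DecoOK : Bool → Bool → Set
DecoOK d v = d ≡ true → v ≡ true

countTrue : List Bool → ℕ
countTrue bs = length (filterᵇ (λ b → b) bs)

range1 : ℕ → List ℕ
range1 n = map suc (upTo n)

record InStLSQ (n k : ℕ) (P : LPath) : Set where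
  field
    square     : IsSquarePath n (path P)
    labelPerm  : labels P ↭ range1 n
    columnsInc : Linked ColOK (zipWith _,_ (map proj₁ (vsteps (path P))) (labels P))
    decoLength : length (decos P) ≡ n
    decoCount  : countTrue (decos P) ≡ k
    decoValley : All (λ dv → DecoOK (proj₁ dv) (proj₂ dv))
                     (zipWith _,_ (decos P) (contractibleValleys P))

-- a decorated letter: (value , decorated?)
DLetter : Set
DLetter = ℕ × Bool

record IsDecPerm (n k : ℕ) (σ : List DLetter) : Set where
  field
    perm      : map proj₁ σ ↭ range1 n
    decoCount : countTrue (map proj₂ σ) ≡ k

cells : LPath → List (ℤ × ℕ × Bool)
cells P = zipWith _,_ (areaWord (path P)) (zipWith _,_ (labels P) (decos P))

-- ρ_i : labels in diagonal (i - s), in decreasing order (we scan the label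
-- values n, n-1, …, 1 and collect the step carrying each of them).
ρ : (n : ℕ) → LPath → ℕ → List DLetter
ρ n P i = concatMap pick (reverse (range1 n))
  where
    pick : ℕ → List DLetter
    pick v = map (λ c → proj₁ (proj₂ c) , proj₂ (proj₂ c))
                 (filterᵇ (λ c → ⌊ proj₁ (proj₂ c) ℕ.≟ v ⌋
                               ∧ ⌊ proj₁ c ℤ.+ shift (path P) ℤ.≟ + i ⌋)
                          (cells P))

-- dw(P) = ρ_0 ρ_1 … ρ_D where D = max_i a_i + s is the last nonempty diagonal
dw : (n : ℕ) → LPath → List DLetter
dw n P = concatMap (ρ n P) (upTo (suc ℤ.∣ maxℤ (areaWord (path P)) ℤ.+ shift (path P) ∣))

-- major index (descent positions counted from 1)
majFrom : ℕ → List ℕ → ℕ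
majFrom i []           = 0
majFrom i (x ∷ [])     = 0
majFrom i (x ∷ y ∷ xs) = (ifB ⌊ y ℕ.<? x ⌋ i) ℕ.+ majFrom (suc i) (y ∷ xs)
  where
    ifB : Bool → ℕ → ℕ
    ifB true  j = j
    ifB false j = 0

maj : List ℕ → ℕ
maj = majFrom 1

revmaj : List DLetter → ℕ
revmaj σ = maj (reverse (map proj₁ σ))

-- Both sides equal Σᵢ i · dᵢ, where dᵢ is the number of vertical steps on the i-th
-- (shifted) diagonal. For the area this is the sum over steps regrouped by diagonal.
-- The diagonal word is the concatenation ρ₀ ρ₁ … ρ_D of decreasing runs, so the ascents
-- of σ, i.e. the descents of its reverse, can only sit at the junctions of consecutive
-- runs; an ascent at the junction of ρᵢ and ρᵢ₊₁ weighs |ρᵢ₊₁| + … + |ρ_D|, and these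
-- weights add up to Σᵢ i · |ρᵢ|. Every junction is an ascent: between the lowest and the
-- highest diagonal the path must, for each i, take two consecutive north steps starting
-- on diagonals i and i + 1, and labels increase up a column.
module Submission where

open import Defs
open import Data.Bool using (Bool; true; false; if_then_else_; _∧_)
open import Data.Nat as ℕ using (ℕ; zero; suc; _+_; _*_; _≤_; _<_; _≥_; _<?_)
import Data.Nat.Properties as ℕP
open import Data.Nat.ListAction using (sum)
open import Data.Nat.ListAction.Properties using (sum-++; sum-↭)
import Data.Nat.Tactic.RingSolver as ℕSolver
open import Data.Integer as ℤ using (ℤ; +_; -_; 0ℤ; 1ℤ; -1ℤ)
import Data.Integer.Properties as ℤP
import Data.Integer.Tactic.RingSolver as ℤSolver
open import Data.List
  using (List; []; _∷_; _++_; _∷ʳ_; length; reverse; concat; concatMap; map; filterᵇ; foldr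
        ; last; upTo; downFrom; applyUpTo; zipWith)
open import Data.List.Properties
  using (unfold-reverse; length-reverse; ++-identityʳ; concat-map; length-map; length-++; map-++
        ; map-∘; foldr-preservesᵒ; foldr-preservesᵇ; reverse-map; reverse-upTo; length-upTo
        ; map-concatMap; concatMap-cong; map-upTo; map-applyUpTo)
open import Data.List.Membership.Propositional using (_∈_)
open import Data.List.Membership.Propositional.Properties using (∈-filter⁺; ∈-filter⁻; ∈-map⁺; ∈-upTo⁺)
open import Data.List.Relation.Unary.Any as Any using (Any; here; there)
import Data.List.Relation.Unary.Any.Properties as AnyP
open import Data.List.Relation.Unary.All as All using (All; []; _∷_)
import Data.List.Relation.Unary.All.Properties as AllP
open import Data.List.Relation.Unary.Linked as Linked using (Linked; []; [-]; _∷_)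
open import Data.List.Relation.Unary.Linked.Properties as LinkedP
  using (Linked⇒All; applyUpTo⁺₁; applyDownFrom⁺₂)
open import Data.List.Relation.Unary.Unique.Propositional using (Unique; []; _∷_)
import Data.List.Relation.Unary.Unique.Propositional.Properties as UniqueP
open import Data.List.Relation.Binary.Permutation.Propositional
  using (_↭_; ↭-refl; ↭-reflexive; ↭-sym; ↭-trans; prep)
open import Data.List.Relation.Binary.Permutation.Propositional.Properties as ↭
  using (++⁺; ++⁺ˡ; ↭-reverse; ∈-resp-↭; All-resp-↭; ↭-length)
open import Data.Maybe using (just)
open import Data.Product using (∃₂; _×_; _,_; proj₁; proj₂)
open import Data.Sum using (_⊎_; inj₁; inj₂; [_,_])
open import Data.Empty using (⊥-elim)
open import Function using (id; _∘_; _on_; flip)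
open import Relation.Nullary.Decidable using (⌊_⌋; yes; no; toWitness; fromWitness)
open import Relation.Binary.Definitions using (DecidableEquality)
open import Relation.Binary.PropositionalEquality hiding ([_])

-- The reverse major index of a concatenation of decreasing runs

-- maj of the reversed word: the ascent wᵢ < wᵢ₊₁ of w is the descent of reverse w at
-- position length w − i.
ascentSuffixSum : List ℕ → ℕ
ascentSuffixSum (x ∷ y ∷ w) = (if ⌊ x <? y ⌋ then length (y ∷ w) else 0) + ascentSuffixSum (y ∷ w)
ascentSuffixSum _           = 0

majFrom-∷∷ : ∀ i x y w →
  majFrom i (x ∷ y ∷ w) ≡ (if ⌊ y <? x ⌋ then i else 0) + majFrom (suc i) (y ∷ w)
majFrom-∷∷ i x y w with ⌊ y <? x ⌋
... | true  = refl
... | false = refl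

majFrom-∷ʳ∷ʳ : ∀ i u y x →
  majFrom i (u ∷ʳ y ∷ʳ x) ≡ majFrom i (u ∷ʳ y) + (if ⌊ x <? y ⌋ then i + length u else 0)
majFrom-∷ʳ∷ʳ i []      y x rewrite ℕP.+-identityʳ i =
  trans (majFrom-∷∷ i y x []) (ℕP.+-identityʳ _)
majFrom-∷ʳ∷ʳ i (z ∷ u) y x = begin
  majFrom i (z ∷ (u ∷ʳ y ∷ʳ x))
    ≡⟨ unfold u ⟩
  first + majFrom (suc i) (u ∷ʳ y ∷ʳ x)
    ≡⟨ cong (_+_ first) (majFrom-∷ʳ∷ʳ (suc i) u y x) ⟩
  first + (majFrom (suc i) (u ∷ʳ y) + ascent (suc i + length u))
    ≡⟨ sym (ℕP.+-assoc first _ _) ⟩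
  first + majFrom (suc i) (u ∷ʳ y) + ascent (suc i + length u)
    ≡⟨ cong₂ _+_ (sym (unfold′ u)) (cong ascent (sym (ℕP.+-suc i (length u)))) ⟩
  majFrom i (z ∷ u ∷ʳ y) + ascent (i + length (z ∷ u))            ∎
  where
  open ≡-Reasoning
  ascent : ℕ → ℕ
  ascent k = if ⌊ x <? y ⌋ then k else 0
  hd : List ℕ → ℕ
  hd []      = y
  hd (a ∷ _) = a
  first : ℕ
  first = if ⌊ hd u <? z ⌋ then i else 0
  unfold : ∀ v →
    majFrom i (z ∷ (v ∷ʳ y ∷ʳ x)) ≡ (if ⌊ hd v <? z ⌋ then i else 0) + majFrom (suc i) (v ∷ʳ y ∷ʳ x)
  unfold []      = majFrom-∷∷ i z y (x ∷ [])
  unfold (a ∷ v) = majFrom-∷∷ i z a (v ∷ʳ y ∷ʳ x)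
  unfold′ : ∀ v →
    majFrom i (z ∷ v ∷ʳ y) ≡ (if ⌊ hd v <? z ⌋ then i else 0) + majFrom (suc i) (v ∷ʳ y)
  unfold′ []      = majFrom-∷∷ i z y []
  unfold′ (a ∷ v) = majFrom-∷∷ i z a (v ∷ʳ y)

maj-reverse : ∀ w → maj (reverse w) ≡ ascentSuffixSum w
maj-reverse []          = refl
maj-reverse (x ∷ [])    = refl
maj-reverse (x ∷ y ∷ r) = begin
  maj (reverse (x ∷ y ∷ r))
    ≡⟨ cong maj (trans (unfold-reverse x (y ∷ r)) (cong (_∷ʳ x) (unfold-reverse y r))) ⟩
  majFrom 1 (reverse r ∷ʳ y ∷ʳ x)
    ≡⟨ majFrom-∷ʳ∷ʳ 1 (reverse r) y x ⟩
  maj (reverse r ∷ʳ y) + ascent (suc (length (reverse r)))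
    ≡⟨ cong₂ _+_ (trans (cong maj (sym (unfold-reverse y r))) (maj-reverse (y ∷ r)))
                 (cong (ascent ∘ suc) (length-reverse r)) ⟩
  ascentSuffixSum (y ∷ r) + ascent (length (y ∷ r))
    ≡⟨ ℕP.+-comm (ascentSuffixSum (y ∷ r)) _ ⟩
  ascentSuffixSum (x ∷ y ∷ r) ∎
  where
  open ≡-Reasoning
  ascent : ℕ → ℕ
  ascent k = if ⌊ x <? y ⌋ then k else 0

ascentSuffixSum-decreasing : ∀ {w} → Linked _≥_ w → ascentSuffixSum w ≡ 0
ascentSuffixSum-decreasing []                     = refl
ascentSuffixSum-decreasing [-]                    = refl
ascentSuffixSum-decreasing {x ∷ y ∷ _} (y≤x ∷ ys) with x <? y
... | yes x<y = ⊥-elim (ℕP.<⇒≱ x<y y≤x)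
... | no  _   = ascentSuffixSum-decreasing ys

ascentSuffixSum-++-ascent : ∀ {xs y} ys → Linked _≥_ xs → Any (_< y) xs →
  ascentSuffixSum (xs ++ y ∷ ys) ≡ length (y ∷ ys) + ascentSuffixSum (y ∷ ys)
ascentSuffixSum-++-ascent {x ∷ []} {y} ys [-] (here x<y) with x <? y
... | yes _   = refl
... | no  x≮y = ⊥-elim (x≮y x<y)
ascentSuffixSum-++-ascent {x ∷ x′ ∷ xs} {y} ys (x′≤x ∷ dec) below with x <? x′
... | yes x<x′ = ⊥-elim (ℕP.<⇒≱ x<x′ x′≤x)
... | no  _    = ascentSuffixSum-++-ascent ys dec (tail-below below)
  where
  tail-below : Any (_< y) (x ∷ x′ ∷ xs) → Any (_< y) (x′ ∷ xs)
  tail-below (here x<y) = here (ℕP.≤-<-trans x′≤x x<y)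
  tail-below (there b)  = b

_↗_ : List ℕ → List ℕ → Set
B ↗ B′ = ∃₂ λ x y → x ∈ B × y ∈ B′ × x < y

-- Σⱼ j · length Bⱼ for Bs = B₀ B₁ …
weightedLength : {A : Set} → List (List A) → ℕ
weightedLength []       = 0
weightedLength (B ∷ Bs) = length (concat Bs) + weightedLength Bs

weightedLength-map : {A B : Set} (f : A → B) (Bs : List (List A)) →
  weightedLength (map (map f) Bs) ≡ weightedLength Bs
weightedLength-map f []       = refl
weightedLength-map f (B ∷ Bs) =
  cong₂ _+_ (trans (cong length (concat-map Bs)) (length-map f (concat Bs))) (weightedLength-map f Bs)

ascentSuffixSum-concat : ∀ {Bs} → All (Linked _≥_) Bs → Linked _↗_ Bs →
  ascentSuffixSum (concat Bs) ≡ weightedLength Bs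
ascentSuffixSum-concat {[]}     _          _ = refl
ascentSuffixSum-concat {B ∷ []} (dec ∷ []) _ =
  trans (cong ascentSuffixSum (++-identityʳ B)) (ascentSuffixSum-decreasing dec)
ascentSuffixSum-concat {B ∷ (y ∷ B′) ∷ Bs} (dec ∷ dec′ ∷ decs) ((x , z , x∈B , z∈B′ , x<z) ∷ ↗s) =
  trans (ascentSuffixSum-++-ascent (B′ ++ concat Bs) dec (Any.map (λ { refl → x<y }) x∈B))
        (cong (_+_ (length (concat ((y ∷ B′) ∷ Bs)))) (ascentSuffixSum-concat (dec′ ∷ decs) ↗s))
  where
  x<y : x < y
  x<y = ℕP.<-≤-trans x<z (All.lookup (Linked⇒All (flip ℕP.≤-trans) ℕP.≤-refl dec′) z∈B′)

filterᵇ-∷ : {A : Set} (r : A → Bool) (x : A) (xs : List A) →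
  filterᵇ r (x ∷ xs) ≡ (if r x then x ∷ filterᵇ r xs else filterᵇ r xs)
filterᵇ-∷ r x xs with r x
... | true  = refl
... | false = refl

filterᵇ-∧ : {A : Set} (p q : A → Bool) (xs : List A) →
  filterᵇ (λ x → p x ∧ q x) xs ≡ filterᵇ p (filterᵇ q xs)
filterᵇ-∧ p q []       = refl
filterᵇ-∧ p q (x ∷ xs)
  rewrite filterᵇ-∷ (λ y → p y ∧ q y) x xs | filterᵇ-∷ q x xs
  with p x in px | q x
... | true  | true  rewrite filterᵇ-∷ p x (filterᵇ q xs) | px = cong (x ∷_) (filterᵇ-∧ p q xs)
... | false | true  rewrite filterᵇ-∷ p x (filterᵇ q xs) | px = filterᵇ-∧ p q xs
... | true  | false = filterᵇ-∧ p q xs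
... | false | false = filterᵇ-∧ p q xs

map-proj₁-zip : {A B : Set} {xs : List A} {ys : List B} →
  length xs ≡ length ys → map proj₁ (zipWith _,_ xs ys) ≡ xs
map-proj₁-zip {xs = []}     {[]}     _  = refl
map-proj₁-zip {xs = x ∷ xs} {_ ∷ ys} eq = cong (x ∷_) (map-proj₁-zip (ℕP.suc-injective eq))

map-proj₂-zip : {A B : Set} {xs : List A} {ys : List B} →
  length xs ≡ length ys → map proj₂ (zipWith _,_ xs ys) ≡ ys
map-proj₂-zip {xs = []}     {[]}     _  = refl
map-proj₂-zip {xs = _ ∷ xs} {y ∷ ys} eq = cong (y ∷_) (map-proj₂-zip (ℕP.suc-injective eq))

concat-applyUpTo-↭ : {A : Set} {f g : ℕ → List A} (t : ℕ) → (∀ i → f i ↭ g i) →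
  concat (applyUpTo f t) ↭ concat (applyUpTo g t)
concat-applyUpTo-↭ zero    f↭g = ↭-refl
concat-applyUpTo-↭ (suc t) f↭g = ++⁺ (f↭g 0) (concat-applyUpTo-↭ t (f↭g ∘ suc))

sum-map-const : {A : Set} (h : A → ℕ) {c : ℕ} {xs : List A} →
  All (λ x → h x ≡ c) xs → sum (map h xs) ≡ c * length xs
sum-map-const h {c} []           = sym (ℕP.*-zeroʳ c)
sum-map-const h {c} (refl ∷ hxs) = trans (cong (_+_ c) (sum-map-const h hxs)) (sym (ℕP.*-suc c _))

sum-map-concat-applyUpTo : {A : Set} (h : A → ℕ) (B : ℕ → List A) (k t : ℕ) →
  (∀ i → All (λ x → h x ≡ k + i) (B i)) →
  sum (map h (concat (applyUpTo B t))) ≡ k * length (concat (applyUpTo B t)) + weightedLength (applyUpTo B t)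
sum-map-concat-applyUpTo h B k zero    _    = sym (cong (_+ 0) (ℕP.*-zeroʳ k))
sum-map-concat-applyUpTo h B k (suc t) hB≡ = begin
  sum (map h (B 0 ++ R))                          ≡⟨ cong sum (map-++ h (B 0) R) ⟩
  sum (map h (B 0) ++ map h R)                    ≡⟨ sum-++ (map h (B 0)) (map h R) ⟩
  sum (map h (B 0)) + sum (map h R)
    ≡⟨ cong₂ _+_ (sum-map-const h (All.map (flip trans (ℕP.+-identityʳ k)) (hB≡ 0)))
                 (sum-map-concat-applyUpTo h (B ∘ suc) (suc k) t
                   (λ i → All.map (flip trans (ℕP.+-suc k i)) (hB≡ (suc i)))) ⟩
  k * length (B 0) + (suc k * length R + W)       ≡⟨ rearrange k (length (B 0)) (length R) W ⟩
  k * (length (B 0) + length R) + (length R + W)  ≡⟨ cong (λ l → k * l + (length R + W)) (sym (length-++ (B 0))) ⟩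
  k * length (B 0 ++ R) + (length R + W)          ∎
  where
  open ≡-Reasoning
  R = concat (applyUpTo (B ∘ suc) t)
  W = weightedLength (applyUpTo (B ∘ suc) t)
  rearrange : ∀ k b r w → k * b + ((1 + k) * r + w) ≡ k * (b + r) + (r + w)
  rearrange = ℕSolver.solve-∀

sumℤ-map-+ : {A : Set} (g : A → ℤ) (h : A → ℕ) {xs : List A} →
  All (λ x → g x ≡ + h x) xs → sumℤ (map g xs) ≡ + sum (map h xs)
sumℤ-map-+ g h {[]}     []           = refl
sumℤ-map-+ g h {x ∷ xs} (gx≡ ∷ gxs≡) =
  trans (cong₂ ℤ._+_ gx≡ (sumℤ-map-+ g h gxs≡)) (sym (ℤP.pos-+ (h x) (sum (map h xs))))

selective-foldr-∈ : {A : Set} {_∙_ : A → A → A} → (∀ x y → x ∙ y ≡ x ⊎ x ∙ y ≡ y) →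
  ∀ a as → foldr _∙_ a as ∈ a ∷ as
selective-foldr-∈ {_∙_ = _∙_} sel a as = foldr-preservesᵇ ∙-∈ (here refl) (All.tabulate there)
  where
  ∙-∈ : ∀ {x y} → x ∈ a ∷ as → y ∈ a ∷ as → x ∙ y ∈ a ∷ as
  ∙-∈ {x} {y} x∈ y∈ =
    [ (λ eq → subst (_∈ a ∷ as) (sym eq) x∈) , (λ eq → subst (_∈ a ∷ as) (sym eq) y∈) ] (sel x y)

minℤ-∈ : ∀ {as} → 0 < length as → minℤ as ∈ as
minℤ-∈ {a ∷ as} _ = selective-foldr-∈ ℤP.⊓-sel a as

maxℤ-∈ : ∀ {as} → 0 < length as → maxℤ as ∈ as
maxℤ-∈ {a ∷ as} _ = selective-foldr-∈ ℤP.⊔-sel a as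

minℤ-≤ : ∀ {as b} → b ∈ as → minℤ as ℤ.≤ b
minℤ-≤ {a ∷ as} {b} b∈ = foldr-preservesᵒ ⊓-≤ a as (split b∈)
  where
  ⊓-≤ : ∀ x y → x ℤ.≤ b ⊎ y ℤ.≤ b → x ℤ.⊓ y ℤ.≤ b
  ⊓-≤ x y = [ ℤP.i≤j⇒i⊓k≤j y , ℤP.i≤j⇒k⊓i≤j x ]
  split : ∀ {a as} → b ∈ a ∷ as → a ℤ.≤ b ⊎ Any (ℤ._≤ b) as
  split (here refl) = inj₁ ℤP.≤-refl
  split (there b∈)  = inj₂ (Any.map (λ { refl → ℤP.≤-refl }) b∈)

maxℤ-≥ : ∀ {as b} → b ∈ as → b ℤ.≤ maxℤ as
maxℤ-≥ {a ∷ as} {b} b∈ = foldr-preservesᵒ ≤-⊔ a as (split b∈)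
  where
  ≤-⊔ : ∀ x y → b ℤ.≤ x ⊎ b ℤ.≤ y → b ℤ.≤ x ℤ.⊔ y
  ≤-⊔ x y = [ ℤP.i≤j⇒i≤j⊔k y , ℤP.i≤j⇒i≤k⊔j x ]
  split : ∀ {a as} → b ∈ a ∷ as → b ℤ.≤ a ⊎ Any (b ℤ.≤_) as
  split (here refl) = inj₁ ℤP.≤-refl
  split (there b∈)  = inj₂ (Any.map (λ { refl → ℤP.≤-refl }) b∈)

-- Bucket sort

module _ {A B : Set} (_≟_ : DecidableEquality B) (f : A → B) where

  bucket : B → List A → List A
  bucket v = filterᵇ (λ x → ⌊ f x ≟ v ⌋)

  bucketSort : List B → List A → List A
  bucketSort vs xs = concatMap (λ v → bucket v xs) vs

  ∈-bucket⁺ : ∀ {v x xs} → x ∈ xs → f x ≡ v → x ∈ bucket v xs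
  ∈-bucket⁺ x∈ fx≡v = ∈-filter⁺ _ x∈ (fromWitness fx≡v)

  ∈-bucket⁻ : ∀ {v x xs} → x ∈ bucket v xs → x ∈ xs × f x ≡ v
  ∈-bucket⁻ x∈ with x∈xs , fx≡v ← ∈-filter⁻ _ x∈ = x∈xs , toWitness fx≡v

  bucket-≡ : ∀ v xs → All (λ x → f x ≡ v) (bucket v xs)
  bucket-≡ v xs = All.tabulate (λ x∈ → proj₂ (∈-bucket⁻ {xs = xs} x∈))

  bucketSort-skip : ∀ {x} xs vs → All (f x ≢_) vs → bucketSort vs (x ∷ xs) ≡ bucketSort vs xs
  bucketSort-skip     xs []       []          = refl
  bucketSort-skip {x} xs (v ∷ vs) (fx≢v ∷ ≢s) with f x ≟ v
  ... | yes fx≡v = ⊥-elim (fx≢v fx≡v)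
  ... | no  _    = cong (bucket v xs ++_) (bucketSort-skip xs vs ≢s)

  bucketSort-∷ : ∀ {x} xs {vs} → Unique vs → f x ∈ vs → bucketSort vs (x ∷ xs) ↭ x ∷ bucketSort vs xs
  bucketSort-∷ {x} xs {v ∷ vs} (v∉vs ∷ uniq) fx∈ with f x ≟ v | fx∈
  ... | yes refl | _         = prep x (↭-reflexive (cong (bucket v xs ++_) (bucketSort-skip xs vs v∉vs)))
  ... | no  fx≢v | here eq   = ⊥-elim (fx≢v eq)
  ... | no  _    | there fx∈ =
    ↭-trans (++⁺ˡ (bucket v xs) (bucketSort-∷ xs uniq fx∈)) (↭.shift x (bucket v xs) _)

  bucketSort-↭ : ∀ {vs} xs → Unique vs → All (λ x → f x ∈ vs) xs → bucketSort vs xs ↭ xs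
  bucketSort-↭ {vs} []       _    _          = ↭-reflexive (empty vs)
    where
    empty : ∀ vs → bucketSort vs [] ≡ []
    empty []       = refl
    empty (_ ∷ vs) = empty vs
  bucketSort-↭      (x ∷ xs) uniq (fx∈ ∷ ∈s) =
    ↭-trans (bucketSort-∷ xs uniq fx∈) (prep x (bucketSort-↭ xs uniq ∈s))

≥-const-++ : ∀ {v w L R} → All (_≡ w) L → w ≤ v → Linked _≥_ (w ∷ R) → Linked _≥_ (v ∷ L ++ R)
≥-const-++ {R = []}    []          w≤v _           = [-]
≥-const-++ {R = _ ∷ _} []          w≤v (y≤w ∷ dec) = ℕP.≤-trans y≤w w≤v ∷ dec
≥-const-++             (refl ∷ ≡s) w≤v dec         = w≤v ∷ ≥-const-++ ≡s ℕP.≤-refl dec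

bucketSort-decreasing : {A : Set} (f : A → ℕ) {vs : List ℕ} (xs : List A) →
  Linked _≥_ vs → Linked _≥_ (map f (bucketSort ℕ._≟_ f vs xs))
bucketSort-decreasing f {[]}    xs _   = []
bucketSort-decreasing f {_ ∷ _} xs dec = Linked.tail (bounded ℕP.≤-refl dec)
  where
  bounded : ∀ {u v vs} → v ≤ u → Linked _≥_ (v ∷ vs) →
    Linked _≥_ (u ∷ map f (bucketSort ℕ._≟_ f (v ∷ vs) xs))
  bounded {v = v} {vs} v≤u dec rewrite map-++ f (bucket ℕ._≟_ f v xs) (bucketSort ℕ._≟_ f vs xs)
    with vs | dec
  ... | []    | _            = ≥-const-++ (AllP.map⁺ (bucket-≡ ℕ._≟_ f v xs)) v≤u [-]
  ... | _ ∷ _ | (w≤v ∷ dec′) = ≥-const-++ (AllP.map⁺ (bucket-≡ ℕ._≟_ f v xs)) v≤u (bounded w≤v dec′)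

-- Lattice paths

-- The vertical steps as pairs (column , level), the level of a lattice point (x , y) being y − x.
vstepsAt : ℕ → ℤ → List Step → List (ℕ × ℤ)
vstepsAt x h []      = []
vstepsAt x h (N ∷ p) = (x , h) ∷ vstepsAt x (ℤ.suc h) p
vstepsAt x h (E ∷ p) = vstepsAt (suc x) (ℤ.pred h) p

vstepsFrom≡vstepsAt : ∀ x y p → vstepsFrom x y p ≡ vstepsAt x (+ y ℤ.- + x) p
vstepsFrom≡vstepsAt x y []      = refl
vstepsFrom≡vstepsAt x y (N ∷ p) = cong ((x , + y ℤ.- + x) ∷_)
  (trans (vstepsFrom≡vstepsAt x (suc y) p) (cong (λ h → vstepsAt x h p) (north (+ y) (+ x))))
  where
  north : ∀ a b → (1ℤ ℤ.+ a) ℤ.- b ≡ 1ℤ ℤ.+ (a ℤ.- b)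
  north = ℤSolver.solve-∀
vstepsFrom≡vstepsAt x y (E ∷ p) =
  trans (vstepsFrom≡vstepsAt (suc x) y p) (cong (λ h → vstepsAt (suc x) h p) (east (+ y) (+ x)))
  where
  east : ∀ a b → a ℤ.- (1ℤ ℤ.+ b) ≡ -1ℤ ℤ.+ (a ℤ.- b)
  east = ℤSolver.solve-∀

#N #E : List Step → ℕ
#N p = length (filterᵇ isN p)
#E p = length (filterᵇ isE p)

length-vstepsAt : ∀ x h p → length (vstepsAt x h p) ≡ #N p
length-vstepsAt x h []      = refl
length-vstepsAt x h (N ∷ p) = cong suc (length-vstepsAt x (ℤ.suc h) p)
length-vstepsAt x h (E ∷ p) = length-vstepsAt (suc x) (ℤ.pred h) p

last≡E⇒#E>0 : ∀ p → last p ≡ just E → 0 < #E p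
last≡E⇒#E>0 (E ∷ [])        _     = ℕ.s≤s ℕ.z≤n
last≡E⇒#E>0 (E ∷ p@(_ ∷ _)) lastE = ℕP.m≤n⇒m≤1+n (last≡E⇒#E>0 p lastE)
last≡E⇒#E>0 (N ∷ p@(_ ∷ _)) lastE = last≡E⇒#E>0 p lastE

endLevel : ℤ → List Step → ℤ
endLevel h []      = h
endLevel h (N ∷ p) = endLevel (ℤ.suc h) p
endLevel h (E ∷ p) = endLevel (ℤ.pred h) p

endLevel≡ : ∀ h p → endLevel h p ≡ h ℤ.+ (+ #N p ℤ.- + #E p)
endLevel≡ h []      = sym (ℤP.+-identityʳ h)
endLevel≡ h (N ∷ p) = trans (endLevel≡ (ℤ.suc h) p) (north h (+ #N p) (+ #E p))
  where
  north : ∀ h n e → (1ℤ ℤ.+ h) ℤ.+ (n ℤ.- e) ≡ h ℤ.+ ((1ℤ ℤ.+ n) ℤ.- e)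
  north = ℤSolver.solve-∀
endLevel≡ h (E ∷ p) = trans (endLevel≡ (ℤ.pred h) p) (east h (+ #N p) (+ #E p))
  where
  east : ∀ h n e → (-1ℤ ℤ.+ h) ℤ.+ (n ℤ.- e) ≡ h ℤ.+ (n ℤ.- (1ℤ ℤ.+ e))
  east = ℤSolver.solve-∀

data Stacked (j : ℤ) : List (ℕ × ℤ) → Set where
  here  : ∀ {x vs} → Stacked j ((x , j) ∷ (x , ℤ.suc j) ∷ vs)
  there : ∀ {v vs} → Stacked j vs → Stacked j (v ∷ vs)

StepAbove StepBelow : ℤ → List (ℕ × ℤ) → Set
StepAbove j = Any ((ℤ.suc j ℤ.≤_) ∘ proj₂)
StepBelow j = Any ((ℤ._≤ j) ∘ proj₂)

-- A north step from level j followed by an east step comes back to level j, so a walk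
-- from level ≤ j that later has a vertical step above j goes north twice in a row from j.
stacked-crossing : ∀ {j} x h p → h ℤ.≤ j → StepAbove j (vstepsAt x h p) → Stacked j (vstepsAt x h p)
stacked-crossing     x h (E ∷ p) h≤j above         =
  stacked-crossing (suc x) (ℤ.pred h) p (ℤP.i≤j⇒pred[i]≤j h≤j) above
stacked-crossing     x h (N ∷ p) h≤j (here j<h)    = ⊥-elim (ℤP.≤⇒≯ h≤j (ℤP.suc[i]≤j⇒i<j j<h))
stacked-crossing {j} x h (N ∷ p) h≤j (there above) with h ℤ.≟ j
... | no h≢j = there (stacked-crossing x (ℤ.suc h) p (ℤP.i<j⇒suc[i]≤j (ℤP.≤∧≢⇒< h≤j h≢j)) above)
stacked-crossing x h (N ∷ N ∷ p) h≤j (there above) | yes refl = here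
stacked-crossing x h (N ∷ E ∷ p) h≤j (there above) | yes refl =
  there (stacked-crossing (suc x) (ℤ.pred (ℤ.suc h)) p (ℤP.≤-reflexive (ℤP.pred-suc h)) above)

suc-cancel-≤ : ∀ {a b} → ℤ.suc a ℤ.≤ ℤ.suc b → a ℤ.≤ b
suc-cancel-≤ {a} {b} le = subst₂ ℤ._≤_ (ℤP.pred-suc a) (ℤP.pred-suc b) (ℤP.pred-mono le)

climbs-above : ∀ {j} x h p → last p ≡ just E → ℤ.suc j ℤ.≤ endLevel h p →
  ℤ.suc (ℤ.suc j) ℤ.≤ h ⊎ StepAbove j (vstepsAt x h p)
climbs-above x h (E ∷ []) _ j<end = inj₁ (subst (_ ℤ.≤_) (ℤP.suc-pred h) (ℤP.suc-mono j<end))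
climbs-above {j} x h (E ∷ p@(_ ∷ _)) lastE j<end with climbs-above {j} (suc x) (ℤ.pred h) p lastE j<end
... | inj₁ le    = inj₁ (ℤP.≤-trans le (ℤP.i≤j⇒pred[i]≤j ℤP.≤-refl))
... | inj₂ above = inj₂ above
climbs-above {j} x h (N ∷ p@(_ ∷ _)) lastE j<end with climbs-above {j} x (ℤ.suc h) p lastE j<end
... | inj₁ le    = inj₂ (here (suc-cancel-≤ le))
... | inj₂ above = inj₂ (there above)

stacked-below : ∀ {j} x h p → last p ≡ just E → ℤ.suc j ℤ.≤ endLevel h p →
  StepBelow j (vstepsAt x h p) → Stacked j (vstepsAt x h p)
stacked-below {j} x h (N ∷ p) lastE j<end (here h≤j) with climbs-above {j} x h (N ∷ p) lastE j<end
... | inj₁ le    = ⊥-elim (ℤP.≤⇒≯ (ℤP.i≤suc[i] j) (ℤP.suc[i]≤j⇒i<j (ℤP.≤-trans le h≤j)))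
... | inj₂ above = stacked-crossing x h (N ∷ p) h≤j above
stacked-below {j} x h (N ∷ p@(_ ∷ _)) lastE j<end (there below) =
  there (stacked-below {j} x (ℤ.suc h) p lastE j<end below)
stacked-below {j} x h (E ∷ p@(_ ∷ _)) lastE j<end below =
  stacked-below {j} (suc x) (ℤ.pred h) p lastE j<end below

module SquarePath {n p} (sq : IsSquarePath n p) where
  open IsSquarePath sq

  vsteps≡vstepsAt : vsteps p ≡ vstepsAt 0 0ℤ p
  vsteps≡vstepsAt = vstepsFrom≡vstepsAt 0 0 p

  length-vsteps : length (vsteps p) ≡ n
  length-vsteps = trans (cong length vsteps≡vstepsAt) (trans (length-vstepsAt 0 0ℤ p) northCount)

  areaWord-nonempty : 0 < length (areaWord p)
  areaWord-nonempty = subst (0 <_) (trans eastCount (sym (trans (length-map proj₂ (vsteps p)) length-vsteps)))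
    (last≡E⇒#E>0 p endsEast)

  endLevel≡0 : endLevel 0ℤ p ≡ 0ℤ
  endLevel≡0 = begin
    endLevel 0ℤ p                   ≡⟨ endLevel≡ 0ℤ p ⟩
    0ℤ ℤ.+ (+ #N p ℤ.- + #E p)      ≡⟨ ℤP.+-identityˡ _ ⟩
    + #N p ℤ.- + #E p               ≡⟨ cong₂ (λ a b → + a ℤ.- + b) northCount eastCount ⟩
    + n ℤ.- + n                     ≡⟨ ℤP.+-inverseʳ (+ n) ⟩
    0ℤ                              ∎
    where open ≡-Reasoning

  -- Diagonals at level ≥ 0 are crossed going up from the start, the others going up to the end.
  stacked-between : ∀ {j} → minℤ (areaWord p) ℤ.≤ j → ℤ.suc j ℤ.≤ maxℤ (areaWord p) →
    Stacked j (vsteps p)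
  stacked-between {j} m≤j j<M with 0ℤ ℤ.≤? j
  ... | yes 0≤j = subst (Stacked j) (sym vsteps≡vstepsAt)
      (stacked-crossing 0 0ℤ p 0≤j (subst (StepAbove j) vsteps≡vstepsAt
        (Any.map (λ eq → subst (ℤ.suc j ℤ.≤_) eq j<M) (AnyP.map⁻ (maxℤ-∈ areaWord-nonempty)))))
  ... | no  0≰j = subst (Stacked j) (sym vsteps≡vstepsAt)
      (stacked-below 0 0ℤ p endsEast
        (subst (ℤ.suc j ℤ.≤_) (sym endLevel≡0) (ℤP.i<j⇒suc[i]≤j (ℤP.≰⇒> 0≰j)))
        (subst (StepBelow j) vsteps≡vstepsAt
          (Any.map (λ eq → subst (ℤ._≤ j) eq m≤j) (AnyP.map⁻ (minℤ-∈ areaWord-nonempty)))))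

-- Labelled paths

Cell : Set
Cell = ℤ × ℕ × Bool

label : Cell → ℕ
label = proj₁ ∘ proj₂

stacked-labels : ∀ {j V ws ds} → Stacked j V → Linked ColOK (zipWith _,_ (map proj₁ V) ws) →
  length ws ≡ length V → length ds ≡ length V →
  let cs = zipWith _,_ (map proj₂ V) (zipWith _,_ ws ds) in
  ∃₂ λ c c′ → c ∈ cs × c′ ∈ cs × proj₁ c ≡ j × proj₁ c′ ≡ ℤ.suc j × label c < label c′
stacked-labels {j} {ws = w ∷ w′ ∷ _} {d ∷ d′ ∷ _} here (w<w′ ∷ _) _ _ =
  (j , w , d) , (ℤ.suc j , w′ , d′) , here refl , there (here refl) , refl , refl , w<w′ refl
stacked-labels {ws = _ ∷ _} {_ ∷ _} (there st) cols lw ld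
  with c , c′ , c∈ , c′∈ , rest
         ← stacked-labels st (Linked.tail cols) (ℕP.suc-injective lw) (ℕP.suc-injective ld) =
  c , c′ , there c∈ , there c′∈ , rest

module LabelledSquarePath {n k p ws ds} (inS : InStLSQ n k (lpath p ws ds)) where
  open InStLSQ inS
  open SquarePath square

  P : LPath
  P = lpath p ws ds

  m M : ℤ
  m = minℤ (areaWord p)
  M = maxℤ (areaWord p)

  D : ℕ
  D = ℤ.∣ M ℤ.+ shift p ∣

  diagonalOf : Cell → ℤ
  diagonalOf c = proj₁ c ℤ.+ shift p

  labelOrder : List ℕ
  labelOrder = reverse (range1 n)

  -- block i lists the cells of the i-th diagonal by decreasing label, as ρ n P i does.
  diagonal block : ℕ → List Cell
  diagonal i = bucket ℤ._≟_ diagonalOf (+ i) (cells P)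
  block i    = bucketSort ℕ._≟_ label labelOrder (diagonal i)

  length-labels : length ws ≡ length (vsteps p)
  length-labels = trans (↭-length labelPerm)
    (trans (length-map suc (upTo n)) (trans (length-upTo n) (sym length-vsteps)))

  length-decos : length ds ≡ length (vsteps p)
  length-decos = trans decoLength (sym length-vsteps)

  map-proj₁-labels-decos : map proj₁ (zipWith _,_ ws ds) ≡ ws
  map-proj₁-labels-decos = map-proj₁-zip (trans length-labels (sym length-decos))

  length-areaWord≡ : length (areaWord p) ≡ length (zipWith _,_ ws ds)
  length-areaWord≡ = begin
    length (areaWord p)                     ≡⟨ length-map proj₂ (vsteps p) ⟩
    length (vsteps p)                       ≡⟨ sym length-labels ⟩
    length ws                               ≡⟨ cong length (sym map-proj₁-labels-decos) ⟩
    length (map proj₁ (zipWith _,_ ws ds))  ≡⟨ length-map proj₁ (zipWith _,_ ws ds) ⟩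
    length (zipWith _,_ ws ds)              ∎
    where open ≡-Reasoning

  map-proj₁-cells : map proj₁ (cells P) ≡ areaWord p
  map-proj₁-cells = map-proj₁-zip length-areaWord≡

  map-label-cells : map label (cells P) ≡ ws
  map-label-cells = trans (map-∘ (cells P))
    (trans (cong (map proj₁) (map-proj₂-zip length-areaWord≡)) map-proj₁-labels-decos)

  label∈labelOrder : ∀ {c} → c ∈ cells P → label c ∈ labelOrder
  label∈labelOrder c∈ = ∈-resp-↭ (↭-sym (↭-reverse (range1 n)))
    (∈-resp-↭ labelPerm (subst (_ ∈_) map-label-cells (∈-map⁺ label c∈)))

  labelOrder≡ : labelOrder ≡ map suc (downFrom n)
  labelOrder≡ = trans (sym (reverse-map suc (upTo n))) (cong (map suc) (reverse-upTo n))

  labelOrder-unique : Unique labelOrder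
  labelOrder-unique = subst Unique (sym labelOrder≡) (UniqueP.map⁺ ℕP.suc-injective (UniqueP.downFrom⁺ n))

  labelOrder-decreasing : Linked _≥_ labelOrder
  labelOrder-decreasing = subst (Linked _≥_) (sym labelOrder≡)
    (LinkedP.map⁺ (applyDownFrom⁺₂ {R = _≥_ on suc} id n (λ i → ℕP.n≤1+n (suc i))))

  +D≡ : + D ≡ M ℤ.+ shift p
  +D≡ = ℤP.0≤i⇒+∣i∣≡i
    (ℤP.i≤j⇒0≤j-i (minℤ-≤ {areaWord p} (maxℤ-∈ {areaWord p} areaWord-nonempty)))

  diagonal-range : ∀ {c} → c ∈ cells P → 0ℤ ℤ.≤ diagonalOf c × diagonalOf c ℤ.≤ + D
  diagonal-range {c} c∈ =
    ℤP.i≤j⇒0≤j-i (minℤ-≤ a∈) ,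
    subst (diagonalOf c ℤ.≤_) (sym +D≡) (ℤP.+-monoˡ-≤ (shift p) (maxℤ-≥ a∈))
    where a∈ = subst (_ ∈_) map-proj₁-cells (∈-map⁺ proj₁ c∈)

  diagonalOf≡+∣∣ : ∀ {c} → c ∈ cells P → diagonalOf c ≡ + ℤ.∣ diagonalOf c ∣
  diagonalOf≡+∣∣ c∈ = sym (ℤP.0≤i⇒+∣i∣≡i (proj₁ (diagonal-range c∈)))

  diagonalOf∈ : ∀ {c} → c ∈ cells P → diagonalOf c ∈ map +_ (upTo (suc D))
  diagonalOf∈ c∈ = subst (_∈ _) (sym (diagonalOf≡+∣∣ c∈)) (∈-map⁺ +_ (∈-upTo⁺ (ℕ.s≤s
    (ℤP.drop‿+≤+ (subst (ℤ._≤ + D) (diagonalOf≡+∣∣ c∈) (proj₂ (diagonal-range c∈)))))))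

  block↭diagonal : ∀ i → block i ↭ diagonal i
  block↭diagonal i = bucketSort-↭ ℕ._≟_ label (diagonal i) labelOrder-unique
    (All.tabulate (λ c∈ → label∈labelOrder (proj₁ (∈-bucket⁻ ℤ._≟_ diagonalOf c∈))))

  blocks↭cells : concat (applyUpTo block (suc D)) ↭ cells P
  blocks↭cells = ↭-trans (concat-applyUpTo-↭ (suc D) block↭diagonal)
    (subst (_↭ cells P) diagonals≡
      (bucketSort-↭ ℤ._≟_ diagonalOf (cells P) levels-unique (All.tabulate diagonalOf∈)))
    where
    levels-unique : Unique (map +_ (upTo (suc D)))
    levels-unique = UniqueP.map⁺ ℤP.+-injective (UniqueP.upTo⁺ (suc D))
    diagonals≡ : bucketSort ℤ._≟_ diagonalOf (map +_ (upTo (suc D))) (cells P) ≡ concat (applyUpTo diagonal (suc D))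
    diagonals≡ = cong concat (trans (sym (map-∘ (upTo (suc D)))) (map-upTo diagonal (suc D)))

  ∈-block : ∀ {c i} → c ∈ cells P → diagonalOf c ≡ + i → c ∈ block i
  ∈-block {i = i} c∈ eq = ∈-resp-↭ (↭-sym (block↭diagonal i)) (∈-bucket⁺ ℤ._≟_ diagonalOf c∈ eq)

  ρ-labels : ∀ i → map proj₁ (ρ n P i) ≡ map label (block i)
  ρ-labels i = begin
    map proj₁ (ρ n P i)
      ≡⟨ map-concatMap proj₁ _ labelOrder ⟩
    concatMap (λ v → map proj₁ (map (λ c → label c , proj₂ (proj₂ c))
                (filterᵇ (λ c → ⌊ label c ℕ.≟ v ⌋ ∧ ⌊ diagonalOf c ℤ.≟ + i ⌋) (cells P))))
              labelOrder
      ≡⟨ concatMap-cong (λ v → trans (sym (map-∘ _)) (cong (map label) (filterᵇ-∧ _ _ (cells P))))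
                        labelOrder ⟩
    concatMap (λ v → map label (bucket ℕ._≟_ label v (diagonal i))) labelOrder
      ≡⟨ sym (map-concatMap label _ labelOrder) ⟩
    map label (block i) ∎
    where open ≡-Reasoning

  dw-labels : map proj₁ (dw n P) ≡ concat (applyUpTo (map label ∘ block) (suc D))
  dw-labels = begin
    map proj₁ (concatMap (ρ n P) (upTo (suc D)))    ≡⟨ map-concatMap proj₁ (ρ n P) (upTo (suc D)) ⟩
    concatMap (map proj₁ ∘ ρ n P) (upTo (suc D))    ≡⟨ concatMap-cong ρ-labels (upTo (suc D)) ⟩
    concatMap (map label ∘ block) (upTo (suc D))    ≡⟨ cong concat (map-upTo (map label ∘ block) (suc D)) ⟩
    concat (applyUpTo (map label ∘ block) (suc D))  ∎
    where open ≡-Reasoning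

  -- The vertical steps listed in ρ n P i start on the line y − x = level i.
  level : ℕ → ℤ
  level i = + i ℤ.+ m

  level-suc : ∀ i → ℤ.suc (level i) ≡ level (suc i)
  level-suc i = suc-+ (+ i) m
    where
    suc-+ : ∀ a b → 1ℤ ℤ.+ (a ℤ.+ b) ≡ (1ℤ ℤ.+ a) ℤ.+ b
    suc-+ = ℤSolver.solve-∀

  min≤level : ∀ i → m ℤ.≤ level i
  min≤level i = ℤP.i≤j⇒i≤k+j (+ i) ℤP.≤-refl

  level<max : ∀ {i} → i < D → ℤ.suc (level i) ℤ.≤ M
  level<max {i} i<D = subst₂ ℤ._≤_ (sym (level-suc i)) (trans (cong (ℤ._+ m) +D≡) (cancel M m))
    (ℤP.+-monoˡ-≤ m (ℤ.+≤+ i<D))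
    where
    cancel : ∀ a b → (a ℤ.+ - b) ℤ.+ b ≡ a
    cancel = ℤSolver.solve-∀

  diagonalOf-level : ∀ {i} c → proj₁ c ≡ level i → diagonalOf c ≡ + i
  diagonalOf-level {i} _ refl = cancel (+ i) m
    where
    cancel : ∀ a b → (a ℤ.+ b) ℤ.+ - b ≡ a
    cancel = ℤSolver.solve-∀

  ascent-between : ∀ {i} → i < D → map label (block i) ↗ map label (block (suc i))
  ascent-between {i} i<D
    with c , c′ , c∈ , c′∈ , c-level , c′-level , c<c′
           ← stacked-labels (stacked-between (min≤level i) (level<max i<D)) columnsInc length-labels length-decos =
    label c , label c′ ,
    ∈-map⁺ label (∈-block c∈ (diagonalOf-level c c-level)) ,
    ∈-map⁺ label (∈-block c′∈ (diagonalOf-level c′ (trans c′-level (level-suc i)))) ,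
    c<c′

  revmaj-dw : revmaj (dw n P) ≡ weightedLength (applyUpTo block (suc D))
  revmaj-dw = begin
    maj (reverse (map proj₁ (dw n P)))                          ≡⟨ maj-reverse (map proj₁ (dw n P)) ⟩
    ascentSuffixSum (map proj₁ (dw n P))                        ≡⟨ cong ascentSuffixSum dw-labels ⟩
    ascentSuffixSum (concat (applyUpTo (map label ∘ block) (suc D)))
      ≡⟨ ascentSuffixSum-concat
           (AllP.applyUpTo⁺₂ _ (suc D) (λ i → bucketSort-decreasing label (diagonal i) labelOrder-decreasing))
           (applyUpTo⁺₁ _ (suc D) (ascent-between ∘ ℕP.≤-pred)) ⟩
    weightedLength (applyUpTo (map label ∘ block) (suc D))
      ≡⟨ cong weightedLength (sym (map-applyUpTo block (map label) (suc D))) ⟩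
    weightedLength (map (map label) (applyUpTo block (suc D)))
      ≡⟨ weightedLength-map label (applyUpTo block (suc D)) ⟩
    weightedLength (applyUpTo block (suc D))                    ∎
    where open ≡-Reasoning

  area-blocks : area p ≡ + weightedLength (applyUpTo block (suc D))
  area-blocks = begin
    sumℤ (map (ℤ._+ shift p) (areaWord p))
      ≡⟨ cong (sumℤ ∘ map (ℤ._+ shift p)) (sym map-proj₁-cells) ⟩
    sumℤ (map (ℤ._+ shift p) (map proj₁ (cells P)))
      ≡⟨ cong sumℤ (sym (map-∘ (cells P))) ⟩
    sumℤ (map diagonalOf (cells P))
      ≡⟨ sumℤ-map-+ diagonalOf index (All.tabulate diagonalOf≡+∣∣) ⟩
    + sum (map index (cells P))
      ≡⟨ cong +_ (sym (sum-↭ (↭.map⁺ index blocks↭cells))) ⟩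
    + sum (map index (concat (applyUpTo block (suc D))))
      ≡⟨ cong +_ (sum-map-concat-applyUpTo index block 0 (suc D) index≡) ⟩
    + weightedLength (applyUpTo block (suc D))
    ∎
    where
    open ≡-Reasoning
    index : Cell → ℕ
    index = ℤ.∣_∣ ∘ diagonalOf
    index≡ : ∀ i → All (λ c → index c ≡ i) (block i)
    index≡ i = All-resp-↭ (↭-sym (block↭diagonal i))
      (All.map (cong ℤ.∣_∣) (bucket-≡ ℤ._≟_ diagonalOf (+ i) (cells P)))

mainTheorem7 : (n k : ℕ) (σ : List DLetter) → IsDecPerm n k σ →
    (P : LPath) → InStLSQ n k P → dw n P ≡ σ → area (path P) ≡ + revmaj σ
mainTheorem7 n k σ _ (lpath p ws ds) inS refl = trans area-blocks (cong +_ (sym revmaj-dw))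
  where open LabelledSquarePath inS
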